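{- Define $b(1)=1$ and $b(n)=n+\sum_m b(m)$ for $n>1$, the sum over all proper divisors $m$ of $n$ (positive divisors $m<n$). Let $p,q,r$ be distinct primes and $c,d,e$ positive integers. Then $$b(p^c)=2b(p^{c-1})+(p-1)p^{c-1},$$ $$b(p^cq^d)=2\big(b(p^{c-1}q^d)+b(p^cq^{d-1})-b(p^{c-1}q^{d-1})\big)+(p-1)(q-1)p^{c-1}q^{d-1},$$ $$b(p^cq^dr^e)=2\big(b(p^{c-1}q^dr^e)+b(p^cq^{d-1}r^e)+b(p^cq^dr^{e-1})-b(p^cq^{d-1}r^{e-1})-b(p^{c-1}q^dr^{e-1})-b(p^{c-1}q^{d-1}r^e)+b(p^{c-1}q^{d-1}r^{e-1})\big)+(p-1)(q-1)(r-1)p^{c-1}q^{d-1}r^{e-1}.$$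
   Context: $b(n)$ is called the sum of recursive divisors of $n$. -}

module Defs where

open import Data.Nat using (ℕ; zero; suc; _+_; _<_; _≤?_)
open import Data.Nat.Divisibility using (_∣?_)
open import Data.List using (List; filter; map; upTo)
open import Data.Nat.ListAction using (sum)
open import Relation.Nullary.Decidable using (does)
open import Data.Bool using (if_then_else_)

properDivisors : ℕ → List ℕ
properDivisors n = filter (λ m → m ∣? n) (map suc (upTo (n Data.Nat.∸ 1)))

-- fuel-indexed recursion; fuel n suffices since proper divisors are < n
bFuel : ℕ → ℕ → ℕ
bFuel zero    n = 1
bFuel (suc f) n =
  if does (n ≤? 1) then 1 else n + sum (map (bFuel f) (properDivisors n))

-- sum of recursive divisors: b 1 = 1, b n = n + Σ_{m ∣ n, m < n} b m (n > 1)
-- (b 0 = 1 is an irrelevant convention)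
b : ℕ → ℕ
b n = bFuel n n

-- Let S k be the sum of b over all divisors of k; the recursion says exactly that S k = 2 b k - k
-- for every k ≥ 1. If each of p, q, r divides n and n has no other prime factors, the proper
-- divisors of n are the divisors of n/p, n/q or n/r, so by inclusion–exclusion
--   b n - n = S (n/p) + S (n/q) + S (n/r) - S (n/pq) - S (n/pr) - S (n/qr) + S (n/pqr).
-- Replacing S by 2 b - id, the moduli add up to n (1 - 1/p) (1 - 1/q) (1 - 1/r), which is
-- (p - 1) (q - 1) (r - 1) n/pqr.
module Submission where

open import Defs
open import Data.Bool using (Bool; true; false; _∧_; _∨_)
open import Data.List using (List; []; _∷_; map)
open import Data.List.Relation.Unary.All as All using (All)
open import Data.Nat
  using (ℕ; zero; suc; pred; _≤_; _<_; _^_; NonZero; >-nonZero; >-nonZero⁻¹; z≤n; s≤s)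
open import Data.Nat.Divisibility using (_∣_; _∣?_; divides; ∣-trans)
open import Data.Nat.ListAction using (sum)
open import Data.Nat.Primality using (Prime)
open import Data.Product using (_×_; _,_; ∃-syntax; map₂)
open import Data.Sum using (_⊎_; inj₁; inj₂; [_,_]′)
open import Function using (_∘_; _⇔_; mk⇔; Equivalence)
open import Relation.Nullary using (Dec; does)
open import Relation.Nullary.Decidable using (does-≡; map′; _×-dec_; _⊎-dec_)
open import Relation.Binary.PropositionalEquality hiding ([_])
open ≡-Reasoning

toℕ : Bool → ℕ
toℕ false = 0
toℕ true  = 1

module DivisorSums where
  open import Data.List using (_++_; [_]; filter; upTo)
  open import Data.List.Properties using (upTo-∷ʳ; map-++)
  open import Data.Nat using (_+_; _*_; _∸_; _≤′_; _≤?_; ≤′-refl; ≤′-step; z<s)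
  open import Data.Nat.Properties
  open import Data.Nat.Divisibility using (∣-refl; >⇒∤)
  open import Data.Nat.ListAction.Properties using (sum-++)
  open import Data.Nat.Tactic.RingSolver using (solve; solve-∀)
  open import Relation.Nullary.Decidable using (dec-true; dec-false)
  open import Relation.Unary using (Pred; Decidable)
  open import Algebra.Properties.CommutativeSemigroup +-commutativeSemigroup using (interchange)

  sumTo : (ℕ → ℕ) → ℕ → ℕ
  sumTo f zero    = 0
  sumTo f (suc K) = sumTo f K + f (suc K)

  sumTo-cong : ∀ {f g} K → (∀ {x} → x ≤ K → f x ≡ g x) → sumTo f K ≡ sumTo g K
  sumTo-cong zero    f≗g = refl
  sumTo-cong (suc K) f≗g = cong₂ _+_ (sumTo-cong K (f≗g ∘ m≤n⇒m≤1+n)) (f≗g ≤-refl)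

  sumTo-0 : ∀ K → sumTo (λ _ → 0) K ≡ 0
  sumTo-0 zero    = refl
  sumTo-0 (suc K) = trans (+-identityʳ _) (sumTo-0 K)

  sumTo-+ : ∀ f g K → sumTo (λ x → f x + g x) K ≡ sumTo f K + sumTo g K
  sumTo-+ f g zero    = refl
  sumTo-+ f g (suc K) = begin
    sumTo (λ x → f x + g x) K + (f (suc K) + g (suc K))
      ≡⟨ cong (_+ (f (suc K) + g (suc K))) (sumTo-+ f g K) ⟩
    sumTo f K + sumTo g K + (f (suc K) + g (suc K))
      ≡⟨ interchange (sumTo f K) (sumTo g K) _ _ ⟩
    sumTo f K + f (suc K) + (sumTo g K + g (suc K)) ∎

  countMultiples : ℕ → List ℕ → ℕ
  countMultiples x ks = sum (map (λ k → toℕ (does (x ∣? k))) ks)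

  divisorSum : (ℕ → ℕ) → ℕ → ℕ → ℕ
  divisorSum f k K = sumTo (λ x → toℕ (does (x ∣? k)) * f x) K

  sum-divisorSum : ∀ f K ks →
    sum (map (λ k → divisorSum f k K) ks) ≡ sumTo (λ x → countMultiples x ks * f x) K
  sum-divisorSum f K []       = sym (sumTo-0 K)
  sum-divisorSum f K (k ∷ ks) = begin
    divisorSum f k K + sum (map (λ k → divisorSum f k K) ks)
      ≡⟨ cong (divisorSum f k K +_) (sum-divisorSum f K ks) ⟩
    divisorSum f k K + sumTo (λ x → countMultiples x ks * f x) K
      ≡⟨ sumTo-+ _ _ K ⟨
    sumTo (λ x → toℕ (does (x ∣? k)) * f x + countMultiples x ks * f x) K
      ≡⟨ sumTo-cong K (λ {x} _ → *-distribʳ-+ (f x) (toℕ (does (x ∣? k))) (countMultiples x ks)) ⟨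
    sumTo (λ x → countMultiples x (k ∷ ks) * f x) K ∎

  divisorSums-cong : ∀ f K ks ls →
    (∀ {x} → x ≤ K → countMultiples x ks ≡ countMultiples x ls) →
    sum (map (λ k → divisorSum f k K) ks) ≡ sum (map (λ l → divisorSum f l K) ls)
  divisorSums-cong f K ks ls balance = begin
    sum (map (λ k → divisorSum f k K) ks)
      ≡⟨ sum-divisorSum f K ks ⟩
    sumTo (λ x → countMultiples x ks * f x) K
      ≡⟨ sumTo-cong K (λ {x} x≤K → cong (_* f x) (balance x≤K)) ⟩
    sumTo (λ x → countMultiples x ls * f x) K
      ≡⟨ sum-divisorSum f K ls ⟨
    sum (map (λ l → divisorSum f l K) ls) ∎

  sum-map-filter : ∀ {p} {P : Pred ℕ p} (P? : Decidable P) f xs →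
    sum (map f (filter P? xs)) ≡ sum (map (λ x → toℕ (does (P? x)) * f x) xs)
  sum-map-filter P? f []       = refl
  sum-map-filter P? f (x ∷ xs) with does (P? x)
  ... | true  = cong₂ _+_ (sym (+-identityʳ (f x))) (sum-map-filter P? f xs)
  ... | false = sum-map-filter P? f xs

  sum-upTo : ∀ g K → sum (map g (map suc (upTo K))) ≡ sumTo g K
  sum-upTo g zero    = refl
  sum-upTo g (suc K) = begin
    sum (map g (map suc (upTo (suc K))))
      ≡⟨ cong (sum ∘ map g ∘ map suc) (upTo-∷ʳ K) ⟨
    sum (map g (map suc (upTo K ++ [ K ])))
      ≡⟨ cong (sum ∘ map g) (map-++ suc (upTo K) [ K ]) ⟩
    sum (map g (map suc (upTo K) ++ [ suc K ]))
      ≡⟨ cong sum (map-++ g (map suc (upTo K)) [ suc K ]) ⟩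
    sum (map g (map suc (upTo K)) ++ [ g (suc K) ])
      ≡⟨ sum-++ (map g (map suc (upTo K))) [ g (suc K) ] ⟩
    sum (map g (map suc (upTo K))) + (g (suc K) + 0)
      ≡⟨ cong₂ _+_ (sum-upTo g K) (+-identityʳ _) ⟩
    sumTo g K + g (suc K) ∎

  sum-properDivisors : ∀ f n → sum (map f (properDivisors n)) ≡ divisorSum f n (n ∸ 1)
  sum-properDivisors f n =
    trans (sum-map-filter (_∣? n) f (map suc (upTo (n ∸ 1)))) (sum-upTo _ (n ∸ 1))

  divisorSum-cong : ∀ {f g} k K → (∀ {x} → x ≤ K → f x ≡ g x) →
    divisorSum f k K ≡ divisorSum g k K
  divisorSum-cong k K f≗g =
    sumTo-cong K (λ {x} x≤K → cong (toℕ (does (x ∣? k)) *_) (f≗g x≤K))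

  divisorSum-trunc : ∀ f {k K} .{{_ : NonZero k}} → k ≤ K → divisorSum f k K ≡ divisorSum f k k
  divisorSum-trunc f {k} k≤K = beyond (≤⇒≤′ k≤K)
    where
    beyond : ∀ {K} → k ≤′ K → divisorSum f k K ≡ divisorSum f k k
    beyond ≤′-refl            = refl
    beyond (≤′-step {K} k≤′K) = begin
      divisorSum f k K + toℕ (does (suc K ∣? k)) * f (suc K)
        ≡⟨ cong (λ t → divisorSum f k K + toℕ t * f (suc K))
                (dec-false (suc K ∣? k) (>⇒∤ (s≤s (≤′⇒≤ k≤′K)))) ⟩
      divisorSum f k K + 0 ≡⟨ +-identityʳ _ ⟩
      divisorSum f k K     ≡⟨ beyond k≤′K ⟩
      divisorSum f k k     ∎

  bFuel-stable : ∀ f g {n} → n ≤ f → n ≤ g → bFuel f n ≡ bFuel g n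
  bFuel-stable zero    zero    _   _   = refl
  bFuel-stable zero    (suc g) z≤n _   = refl
  bFuel-stable (suc f) zero    _   z≤n = refl
  bFuel-stable (suc f) (suc g) {n} n≤f n≤g with does (n ≤? 1)
  ... | true  = refl
  ... | false = cong (n +_) (begin
    sum (map (bFuel f) (properDivisors n)) ≡⟨ sum-properDivisors (bFuel f) n ⟩
    divisorSum (bFuel f) n (n ∸ 1)         ≡⟨ divisorSum-cong n (n ∸ 1) (λ x≤n∸1 →
      bFuel-stable f g (≤-trans x≤n∸1 (∸-monoˡ-≤ 1 n≤f))
                       (≤-trans x≤n∸1 (∸-monoˡ-≤ 1 n≤g))) ⟩
    divisorSum (bFuel g) n (n ∸ 1)         ≡⟨ sum-properDivisors (bFuel g) n ⟨
    sum (map (bFuel g) (properDivisors n)) ∎)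

  b-unfold : ∀ {n} → 1 < n → b n ≡ n + divisorSum b n (pred n)
  b-unfold {n@(suc (suc k))} (s≤s (s≤s z≤n)) = cong (n +_) (begin
    sum (map (bFuel (suc k)) (properDivisors n))
      ≡⟨ sum-properDivisors (bFuel (suc k)) n ⟩
    divisorSum (bFuel (suc k)) n (suc k)
      ≡⟨ divisorSum-cong n (suc k) (λ x≤1+k → bFuel-stable (suc k) _ x≤1+k ≤-refl) ⟩
    divisorSum b n (suc k) ∎)

  divisorSum-b-self : ∀ k .{{_ : NonZero k}} → divisorSum b k k + k ≡ 2 * b k
  divisorSum-b-self 1                  = refl
  divisorSum-b-self n@(suc (suc k)) = begin
    divisorSum b n (suc k) + toℕ (does (n ∣? n)) * b n + n
      ≡⟨ cong (λ t → divisorSum b n (suc k) + toℕ t * b n + n) (dec-true (n ∣? n) ∣-refl) ⟩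
    divisorSum b n (suc k) + 1 * b n + n
      ≡⟨ doubling (divisorSum b n (suc k)) n (b-unfold {n} (s≤s (s≤s z≤n))) ⟩
    2 * b n ∎
    where
    doubling : ∀ D m {B} → B ≡ m + D → D + 1 * B + m ≡ 2 * B
    doubling D m refl = solve (D ∷ m ∷ [])

  divisorSum-b : ∀ {k K} .{{_ : NonZero k}} → k ≤ K → divisorSum b k K + k ≡ 2 * b k
  divisorSum-b {k} k≤K = trans (cong (_+ k) (divisorSum-trunc b k≤K)) (divisorSum-b-self k)

  sum-divisorSum-b : ∀ {K} ks → All (λ k → 0 < k × k ≤ K) ks →
    sum (map (λ k → divisorSum b k K) ks) + sum ks ≡ 2 * sum (map b ks)
  sum-divisorSum-b []       All.[]                         = refl
  sum-divisorSum-b {K} (k ∷ ks) ((0<k , k≤K) All.∷ bounds) = begin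
    divisorSum b k K + sum (map (λ k → divisorSum b k K) ks) + (k + sum ks)
      ≡⟨ interchange (divisorSum b k K) _ k (sum ks) ⟩
    divisorSum b k K + k + (sum (map (λ k → divisorSum b k K) ks) + sum ks)
      ≡⟨ cong₂ _+_ (divisorSum-b {{>-nonZero 0<k}} k≤K) (sum-divisorSum-b ks bounds) ⟩
    2 * b k + 2 * sum (map b ks)
      ≡⟨ *-distribˡ-+ 2 (b k) (sum (map b ks)) ⟨
    2 * sum (map b (k ∷ ks)) ∎

  -- Inclusion–exclusion for the proper divisors of n: the terms of ls carry sign +, those of ks
  -- sign -, and the two are kept on opposite sides of balance so that everything stays in ℕ.
  record InclusionExclusion (n : ℕ) (ks ls : List ℕ) : Set where
    field
      nontrivial : 1 < n
      ks-proper  : All (λ k → 0 < k × k < n) ks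
      ls-proper  : All (λ l → 0 < l × l < n) ls
      balance    : ∀ {x} → x < n → countMultiples x (n ∷ ks) ≡ countMultiples x ls

  b-balance : ∀ {n ks ls} → InclusionExclusion n ks ls →
    b n + 2 * sum (map b ks) + sum ls ≡ n + 2 * sum (map b ls) + sum ks
  b-balance {n} {ks} {ls} ie = begin
    b n + 2 * Bₖ + Sₗ
      ≡⟨ cong (λ t → t + 2 * Bₖ + Sₗ) (b-unfold nontrivial) ⟩
    n + D n + 2 * Bₖ + Sₗ
      ≡⟨ cong (λ t → n + D n + t + Sₗ) (sum-divisorSum-b ks (below ks-proper)) ⟨
    n + D n + (Dₖ + Sₖ) + Sₗ
      ≡⟨ shuffle n (D n) Dₖ Sₖ Sₗ ⟩
    n + (D n + Dₖ) + Sₗ + Sₖ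
      ≡⟨ cong (λ t → n + t + Sₗ + Sₖ)
              (divisorSums-cong b (pred n) (n ∷ ks) ls (balance ∘ ≤pred⇒<)) ⟩
    n + Dₗ + Sₗ + Sₖ
      ≡⟨ cong (_+ Sₖ) (+-assoc n Dₗ Sₗ) ⟩
    n + (Dₗ + Sₗ) + Sₖ
      ≡⟨ cong (λ t → n + t + Sₖ) (sum-divisorSum-b ls (below ls-proper)) ⟩
    n + 2 * Bₗ + Sₖ ∎
    where
    open InclusionExclusion ie
    D : ℕ → ℕ
    D k = divisorSum b k (pred n)
    Bₖ Bₗ Dₖ Dₗ Sₖ Sₗ : ℕ
    Bₖ = sum (map b ks)
    Bₗ = sum (map b ls)
    Dₖ = sum (map D ks)
    Dₗ = sum (map D ls)
    Sₖ = sum ks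
    Sₗ = sum ls
    below : ∀ {js} → All (λ j → 0 < j × j < n) js → All (λ j → 0 < j × j ≤ pred n) js
    below = All.map (map₂ <⇒≤pred)
    ≤pred⇒< : ∀ {x} → x ≤ pred n → x < n
    ≤pred⇒< = m≤pred[n]⇒suc[m]≤n {{>-nonZero (<-trans z<s nontrivial)}}
    shuffle : ∀ u v w x y → u + v + (w + x) + y ≡ u + (v + w) + y + x
    shuffle = solve-∀

module PrimeDivisors where
  open import Data.Nat using (_*_; nonTrivial⇒n>1; z<s)
  open import Data.Nat.Properties using (<-trans; <-irrefl; *-comm; *-assoc; m<m*n)
  open import Data.Nat.ListAction using (product)
  open import Data.Nat.Divisibility using (∣1⇒≡1; *-cancelˡ-∣; quotient>1; m∣m*n)
  open import Data.Nat.Primality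
    using (¬prime[1]; prime⇒irreducible; prime⇒nonZero; prime⇒nonTrivial; euclidsLemma)
  open import Data.Nat.Primality.Factorisation using (factorise)
  open import Data.Nat.Coprimality using (Coprime; coprime-factors)
  open import Relation.Nullary using (contradiction)

  prime∣prime⇒≡ : ∀ {s p} → Prime s → Prime p → s ∣ p → s ≡ p
  prime∣prime⇒≡ s-prime p-prime s∣p with prime⇒irreducible p-prime s∣p
  ... | inj₁ refl = contradiction s-prime ¬prime[1]
  ... | inj₂ s≡p  = s≡p

  prime∣^⇒≡ : ∀ {s p} i → Prime s → Prime p → s ∣ p ^ i → s ≡ p
  prime∣^⇒≡ zero s-prime _ s∣1 = contradiction (subst Prime (∣1⇒≡1 s∣1) s-prime) ¬prime[1]
  prime∣^⇒≡ {p = p} (suc i) s-prime p-prime s∣p^[1+i] with euclidsLemma p (p ^ i) s-prime s∣p^[1+i]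
  ... | inj₁ s∣p   = prime∣prime⇒≡ s-prime p-prime s∣p
  ... | inj₂ s∣p^i = prime∣^⇒≡ i s-prime p-prime s∣p^i

  distinct-primes-coprime : ∀ {p q} → Prime p → Prime q → p ≢ q → Coprime p q
  distinct-primes-coprime p-prime q-prime p≢q (d∣p , d∣q) with prime⇒irreducible p-prime d∣p
  ... | inj₁ d≡1 = d≡1
  ... | inj₂ refl = contradiction (prime∣prime⇒≡ p-prime q-prime d∣q) p≢q

  prime-divisor : ∀ {k} → 1 < k → ∃[ s ] Prime s × s ∣ k
  prime-divisor {k} 1<k with factorise k {{>-nonZero (<-trans z<s 1<k)}}
  ... | record { factors = [] ; isFactorisation = k≡1 } =
    contradiction (subst (1 <_) k≡1 1<k) (<-irrefl refl)
  ... | record { factors = s ∷ ss ; isFactorisation = k≡s*Πss ; factorsPrime = s-prime All.∷ _ } =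
    s , s-prime , subst (s ∣_) (sym k≡s*Πss) (m∣m*n (product ss))

  proper-divisor⇒prime-multiple : ∀ {x n} → x ∣ n → x < n → ∃[ s ] Prime s × s * x ∣ n
  proper-divisor⇒prime-multiple {x} {n} x∣n@(divides q n≡q*x) x<n
    with prime-divisor (quotient>1 x∣n x<n)
  ... | s , s-prime , divides t q≡t*s = s , s-prime , divides t (begin
    n           ≡⟨ n≡q*x ⟩
    q * x       ≡⟨ cong (_* x) q≡t*s ⟩
    t * s * x   ≡⟨ *-assoc t s x ⟩
    t * (s * x) ∎)

  cofactor-∣ : ∀ s {M N x} → M ≡ s * N → x ∣ N → x ∣ M
  cofactor-∣ s M≡s*N x∣N = ∣-trans x∣N (divides s M≡s*N)

  cofactor-cancel : ∀ {s M N x} → Prime s → M ≡ s * N → s * x ∣ M → x ∣ N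
  cofactor-cancel {s} s-prime refl = *-cancelˡ-∣ s {{prime⇒nonZero s-prime}}

  cofactor-< : ∀ {s M N} → Prime s → 0 < N → M ≡ s * N → N < M
  cofactor-< {s} {N = N} s-prime 0<N refl =
    subst (N <_) (*-comm N s)
      (m<m*n N s {{>-nonZero 0<N}} (nonTrivial⇒n>1 s {{prime⇒nonTrivial s-prime}}))

  common-cofactor : ∀ {s t M₁ M₂ N x} → Prime s → Prime t → s ≢ t →
    M₁ ≡ s * N → M₂ ≡ t * N → x ∣ M₁ → x ∣ M₂ → x ∣ N
  common-cofactor s-prime t-prime s≢t refl refl x∣M₁ x∣M₂ =
    coprime-factors (distinct-primes-coprime s-prime t-prime s≢t) (x∣M₁ , x∣M₂)

does-⇔ : ∀ {a b} {A : Set a} {B : Set b} → A ⇔ B → (a? : Dec A) (b? : Dec B) → does a? ≡ does b?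
does-⇔ A⇔B a? b? = does-≡ a? (map′ from to b?)
  where open Equivalence A⇔B

inclusion-exclusion₂ : ∀ {t uv} u v → t ≡ u ∨ v → uv ≡ u ∧ v →
  sum (map toℕ (t ∷ uv ∷ [])) ≡ sum (map toℕ (u ∷ v ∷ []))
inclusion-exclusion₂ true  v refl refl = refl
inclusion-exclusion₂ false v refl refl = refl

inclusion-exclusion₃ : ∀ {t uv uw vw uvw} u v w →
  t ≡ u ∨ v ∨ w → uv ≡ u ∧ v → uw ≡ u ∧ w → vw ≡ v ∧ w → uvw ≡ u ∧ v ∧ w →
  sum (map toℕ (t ∷ uv ∷ uw ∷ vw ∷ [])) ≡ sum (map toℕ (u ∷ v ∷ w ∷ uvw ∷ []))
inclusion-exclusion₃ true  v     w refl refl refl refl refl = refl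
inclusion-exclusion₃ false true  w refl refl refl refl refl = refl
inclusion-exclusion₃ false false w refl refl refl refl refl = refl

module PrimePower {p : ℕ} (p-prime : Prime p) (c : ℕ) where
  open import Data.Nat.Properties using (≤-<-trans; m^n≢0)
  open import Data.Nat.Divisibility using (m∣m*n)
  open import Data.Nat.Primality using (prime⇒nonZero)
  open PrimeDivisors
  open DivisorSums using (InclusionExclusion)

  p^c>0 : 0 < p ^ c
  p^c>0 = >-nonZero⁻¹ (p ^ c) {{m^n≢0 p c {{prime⇒nonZero p-prime}}}}

  p^c<p^[1+c] : p ^ c < p ^ suc c
  p^c<p^[1+c] = cofactor-< p-prime p^c>0 refl

  divides-p^[1+c]⇔ : ∀ {x} → x < p ^ suc c → x ∣ p ^ suc c ⇔ x ∣ p ^ c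
  divides-p^[1+c]⇔ {x} x<p^[1+c] = mk⇔ to (cofactor-∣ p refl)
    where
    to : x ∣ p ^ suc c → x ∣ p ^ c
    to x∣p^[1+c] with proper-divisor⇒prime-multiple x∣p^[1+c] x<p^[1+c]
    ... | s , s-prime , s*x∣p^[1+c]
        with prime∣^⇒≡ (suc c) s-prime p-prime (∣-trans (m∣m*n x) s*x∣p^[1+c])
    ...   | refl = cofactor-cancel p-prime refl s*x∣p^[1+c]

  inclusion-exclusion : InclusionExclusion (p ^ suc c) [] (p ^ c ∷ [])
  inclusion-exclusion = record
    { nontrivial = ≤-<-trans p^c>0 p^c<p^[1+c]
    ; ks-proper  = All.[]
    ; ls-proper  = (p^c>0 , p^c<p^[1+c]) All.∷ All.[]
    ; balance    = λ {x} x<p^[1+c] →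
        cong (λ u → sum (map toℕ (u ∷ [])))
             (does-⇔ (divides-p^[1+c]⇔ x<p^[1+c]) (x ∣? p ^ suc c) (x ∣? p ^ c))
    }

module TwoPrimePowers {p q : ℕ} (p-prime : Prime p) (q-prime : Prime q) (p≢q : p ≢ q) where
  open import Data.Nat using (_*_)
  open import Data.Nat.Properties
    using (≤-<-trans; <-trans; *-assoc; m*n≢0; m^n≢0; *-commutativeSemigroup)
  open import Data.Nat.Divisibility using (m∣m*n)
  open import Data.Nat.Primality using (prime⇒nonZero; euclidsLemma)
  open import Algebra.Properties.CommutativeSemigroup *-commutativeSemigroup using (x∙yz≈y∙xz)
  open PrimeDivisors
  open DivisorSums using (InclusionExclusion)

  m : ℕ → ℕ → ℕ
  m i j = p ^ i * q ^ j

  m>0 : ∀ i j → 0 < m i j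
  m>0 i j = >-nonZero⁻¹ (m i j) {{m*n≢0 (p ^ i) (q ^ j)}}
    where
    instance
      p^i≢0 : NonZero (p ^ i)
      p^i≢0 = m^n≢0 p i {{prime⇒nonZero p-prime}}
      q^j≢0 : NonZero (q ^ j)
      q^j≢0 = m^n≢0 q j {{prime⇒nonZero q-prime}}

  m-sucᵖ : ∀ i j → m (suc i) j ≡ p * m i j
  m-sucᵖ i j = *-assoc p (p ^ i) (q ^ j)

  m-sucᵠ : ∀ i j → m i (suc j) ≡ q * m i j
  m-sucᵠ i j = x∙yz≈y∙xz (p ^ i) q (q ^ j)

  prime∣m : ∀ {s} i j → Prime s → s ∣ m i j → s ≡ p ⊎ s ≡ q
  prime∣m i j s-prime s∣m with euclidsLemma (p ^ i) (q ^ j) s-prime s∣m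
  ... | inj₁ s∣p^i = inj₁ (prime∣^⇒≡ i s-prime p-prime s∣p^i)
  ... | inj₂ s∣q^j = inj₂ (prime∣^⇒≡ j s-prime q-prime s∣q^j)

  module Cofactors (c d : ℕ) where
    n n/p n/q n/pq : ℕ
    n    = m (suc c) (suc d)
    n/p  = m c (suc d)
    n/q  = m (suc c) d
    n/pq = m c d

    divides-n⇔ : ∀ {x} → x < n → x ∣ n ⇔ (x ∣ n/p ⊎ x ∣ n/q)
    divides-n⇔ {x} x<n =
      mk⇔ to [ cofactor-∣ p (m-sucᵖ c (suc d)) , cofactor-∣ q (m-sucᵠ (suc c) d) ]′
      where
      to : x ∣ n → x ∣ n/p ⊎ x ∣ n/q
      to x∣n with proper-divisor⇒prime-multiple x∣n x<n
      ... | s , s-prime , s*x∣n with prime∣m (suc c) (suc d) s-prime (∣-trans (m∣m*n x) s*x∣n)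
      ... | inj₁ refl = inj₁ (cofactor-cancel p-prime (m-sucᵖ c (suc d)) s*x∣n)
      ... | inj₂ refl = inj₂ (cofactor-cancel q-prime (m-sucᵠ (suc c) d) s*x∣n)

    divides-n/pq⇔ : ∀ {x} → x ∣ n/pq ⇔ (x ∣ n/p × x ∣ n/q)
    divides-n/pq⇔ = mk⇔
      (λ x∣n/pq → cofactor-∣ q (m-sucᵠ c d) x∣n/pq , cofactor-∣ p (m-sucᵖ c d) x∣n/pq)
      (λ (x∣n/p , x∣n/q) →
        common-cofactor q-prime p-prime (p≢q ∘ sym) (m-sucᵠ c d) (m-sucᵖ c d) x∣n/p x∣n/q)

    n/p<n : n/p < n
    n/p<n = cofactor-< p-prime (m>0 c (suc d)) (m-sucᵖ c (suc d))

    n/q<n : n/q < n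
    n/q<n = cofactor-< q-prime (m>0 (suc c) d) (m-sucᵠ (suc c) d)

    n/pq<n : n/pq < n
    n/pq<n = <-trans (cofactor-< q-prime (m>0 c d) (m-sucᵠ c d)) n/p<n

    inclusion-exclusion : InclusionExclusion n (n/pq ∷ []) (n/p ∷ n/q ∷ [])
    inclusion-exclusion = record
      { nontrivial = ≤-<-trans (m>0 c (suc d)) n/p<n
      ; ks-proper  = (m>0 c d , n/pq<n) All.∷ All.[]
      ; ls-proper  = (m>0 c (suc d) , n/p<n) All.∷ (m>0 (suc c) d , n/q<n) All.∷ All.[]
      ; balance    = λ {x} x<n → inclusion-exclusion₂ (does (x ∣? n/p)) (does (x ∣? n/q))
          (does-⇔ (divides-n⇔ x<n) (x ∣? n) (x ∣? n/p ⊎-dec x ∣? n/q))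
          (does-⇔ divides-n/pq⇔ (x ∣? n/pq) (x ∣? n/p ×-dec x ∣? n/q))
      }


module ThreePrimePowers {p q r : ℕ} (p-prime : Prime p) (q-prime : Prime q) (r-prime : Prime r)
                        (p≢q : p ≢ q) (p≢r : p ≢ r) (q≢r : q ≢ r) where
  open import Data.Nat using (_*_)
  open import Data.Nat.Properties using (≤-<-trans; <-trans; m*n≢0; m^n≢0)
  open import Data.Nat.Divisibility using (m∣m*n)
  open import Data.Nat.Primality using (prime⇒nonZero; euclidsLemma)
  open import Data.Nat.Tactic.RingSolver using (solve-∀)
  open PrimeDivisors
  open DivisorSums using (InclusionExclusion)

  m : ℕ → ℕ → ℕ → ℕ
  m i j k = p ^ i * q ^ j * r ^ k

  m>0 : ∀ i j k → 0 < m i j k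
  m>0 i j k = >-nonZero⁻¹ (m i j k) {{m*n≢0 (p ^ i * q ^ j) (r ^ k) {{m*n≢0 (p ^ i) (q ^ j)}}}}
    where
    instance
      p^i≢0 : NonZero (p ^ i)
      p^i≢0 = m^n≢0 p i {{prime⇒nonZero p-prime}}
      q^j≢0 : NonZero (q ^ j)
      q^j≢0 = m^n≢0 q j {{prime⇒nonZero q-prime}}
      r^k≢0 : NonZero (r ^ k)
      r^k≢0 = m^n≢0 r k {{prime⇒nonZero r-prime}}

  m-sucᵖ : ∀ i j k → m (suc i) j k ≡ p * m i j k
  m-sucᵖ i j k = pull p (p ^ i) (q ^ j) (r ^ k)
    where
    pull : ∀ x a b c → x * a * b * c ≡ x * (a * b * c)
    pull = solve-∀

  m-sucᵠ : ∀ i j k → m i (suc j) k ≡ q * m i j k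
  m-sucᵠ i j k = pull q (p ^ i) (q ^ j) (r ^ k)
    where
    pull : ∀ x a b c → a * (x * b) * c ≡ x * (a * b * c)
    pull = solve-∀

  m-sucʳ : ∀ i j k → m i j (suc k) ≡ r * m i j k
  m-sucʳ i j k = pull r (p ^ i) (q ^ j) (r ^ k)
    where
    pull : ∀ x a b c → a * b * (x * c) ≡ x * (a * b * c)
    pull = solve-∀

  prime∣m : ∀ {s} i j k → Prime s → s ∣ m i j k → s ≡ p ⊎ s ≡ q ⊎ s ≡ r
  prime∣m i j k s-prime s∣m with euclidsLemma (p ^ i * q ^ j) (r ^ k) s-prime s∣m
  ... | inj₂ s∣r^k = inj₂ (inj₂ (prime∣^⇒≡ k s-prime r-prime s∣r^k))
  ... | inj₁ s∣p^i*q^j with euclidsLemma (p ^ i) (q ^ j) s-prime s∣p^i*q^j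
  ...   | inj₁ s∣p^i = inj₁ (prime∣^⇒≡ i s-prime p-prime s∣p^i)
  ...   | inj₂ s∣q^j = inj₂ (inj₁ (prime∣^⇒≡ j s-prime q-prime s∣q^j))

  module Cofactors (c d e : ℕ) where
    n n/p n/q n/r n/pq n/pr n/qr n/pqr : ℕ
    n     = m (suc c) (suc d) (suc e)
    n/p   = m c (suc d) (suc e)
    n/q   = m (suc c) d (suc e)
    n/r   = m (suc c) (suc d) e
    n/pq  = m c d (suc e)
    n/pr  = m c (suc d) e
    n/qr  = m (suc c) d e
    n/pqr = m c d e

    divides-n⇔ : ∀ {x} → x < n → x ∣ n ⇔ (x ∣ n/p ⊎ x ∣ n/q ⊎ x ∣ n/r)
    divides-n⇔ {x} x<n = mk⇔ to
      [ cofactor-∣ p (m-sucᵖ c (suc d) (suc e))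
      , [ cofactor-∣ q (m-sucᵠ (suc c) d (suc e)) , cofactor-∣ r (m-sucʳ (suc c) (suc d) e) ]′ ]′
      where
      to : x ∣ n → x ∣ n/p ⊎ x ∣ n/q ⊎ x ∣ n/r
      to x∣n with proper-divisor⇒prime-multiple x∣n x<n
      ... | s , s-prime , s*x∣n
          with prime∣m (suc c) (suc d) (suc e) s-prime (∣-trans (m∣m*n x) s*x∣n)
      ...   | inj₁ refl        = inj₁ (cofactor-cancel p-prime (m-sucᵖ c (suc d) (suc e)) s*x∣n)
      ...   | inj₂ (inj₁ refl) = inj₂ (inj₁ (cofactor-cancel q-prime (m-sucᵠ (suc c) d (suc e)) s*x∣n))
      ...   | inj₂ (inj₂ refl) = inj₂ (inj₂ (cofactor-cancel r-prime (m-sucʳ (suc c) (suc d) e) s*x∣n))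

    divides-n/pq⇔ : ∀ {x} → x ∣ n/pq ⇔ (x ∣ n/p × x ∣ n/q)
    divides-n/pq⇔ = mk⇔
      (λ x∣n/pq → cofactor-∣ q (m-sucᵠ c d (suc e)) x∣n/pq ,
                  cofactor-∣ p (m-sucᵖ c d (suc e)) x∣n/pq)
      (λ (x∣n/p , x∣n/q) → common-cofactor q-prime p-prime (p≢q ∘ sym)
                             (m-sucᵠ c d (suc e)) (m-sucᵖ c d (suc e)) x∣n/p x∣n/q)

    divides-n/pr⇔ : ∀ {x} → x ∣ n/pr ⇔ (x ∣ n/p × x ∣ n/r)
    divides-n/pr⇔ = mk⇔
      (λ x∣n/pr → cofactor-∣ r (m-sucʳ c (suc d) e) x∣n/pr ,
                  cofactor-∣ p (m-sucᵖ c (suc d) e) x∣n/pr)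
      (λ (x∣n/p , x∣n/r) → common-cofactor r-prime p-prime (p≢r ∘ sym)
                             (m-sucʳ c (suc d) e) (m-sucᵖ c (suc d) e) x∣n/p x∣n/r)

    divides-n/qr⇔ : ∀ {x} → x ∣ n/qr ⇔ (x ∣ n/q × x ∣ n/r)
    divides-n/qr⇔ = mk⇔
      (λ x∣n/qr → cofactor-∣ r (m-sucʳ (suc c) d e) x∣n/qr ,
                  cofactor-∣ q (m-sucᵠ (suc c) d e) x∣n/qr)
      (λ (x∣n/q , x∣n/r) → common-cofactor r-prime q-prime (q≢r ∘ sym)
                             (m-sucʳ (suc c) d e) (m-sucᵠ (suc c) d e) x∣n/q x∣n/r)

    divides-n/pqr⇔ : ∀ {x} → x ∣ n/pqr ⇔ (x ∣ n/p × x ∣ n/q × x ∣ n/r)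
    divides-n/pqr⇔ = mk⇔
      (λ x∣n/pqr →
        let (x∣n/p , x∣n/q) = Equivalence.to divides-n/pq⇔ (cofactor-∣ r (m-sucʳ c d e) x∣n/pqr)
            (_ , x∣n/r)     = Equivalence.to divides-n/pr⇔ (cofactor-∣ q (m-sucᵠ c d e) x∣n/pqr)
        in x∣n/p , x∣n/q , x∣n/r)
      (λ (x∣n/p , x∣n/q , x∣n/r) →
        common-cofactor r-prime q-prime (q≢r ∘ sym) (m-sucʳ c d e) (m-sucᵠ c d e)
          (Equivalence.from divides-n/pq⇔ (x∣n/p , x∣n/q))
          (Equivalence.from divides-n/pr⇔ (x∣n/p , x∣n/r)))

    n/p<n : n/p < n
    n/p<n = cofactor-< p-prime (m>0 c (suc d) (suc e)) (m-sucᵖ c (suc d) (suc e))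

    n/q<n : n/q < n
    n/q<n = cofactor-< q-prime (m>0 (suc c) d (suc e)) (m-sucᵠ (suc c) d (suc e))

    n/r<n : n/r < n
    n/r<n = cofactor-< r-prime (m>0 (suc c) (suc d) e) (m-sucʳ (suc c) (suc d) e)

    n/pq<n : n/pq < n
    n/pq<n = <-trans (cofactor-< q-prime (m>0 c d (suc e)) (m-sucᵠ c d (suc e))) n/p<n

    n/pr<n : n/pr < n
    n/pr<n = <-trans (cofactor-< r-prime (m>0 c (suc d) e) (m-sucʳ c (suc d) e)) n/p<n

    n/qr<n : n/qr < n
    n/qr<n = <-trans (cofactor-< r-prime (m>0 (suc c) d e) (m-sucʳ (suc c) d e)) n/q<n

    n/pqr<n : n/pqr < n
    n/pqr<n = <-trans (cofactor-< r-prime (m>0 c d e) (m-sucʳ c d e)) n/pq<n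

    inclusion-exclusion :
      InclusionExclusion n (n/pq ∷ n/pr ∷ n/qr ∷ []) (n/p ∷ n/q ∷ n/r ∷ n/pqr ∷ [])
    inclusion-exclusion = record
      { nontrivial = ≤-<-trans (m>0 c (suc d) (suc e)) n/p<n
      ; ks-proper  = (m>0 c d (suc e) , n/pq<n) All.∷ (m>0 c (suc d) e , n/pr<n)
                     All.∷ (m>0 (suc c) d e , n/qr<n) All.∷ All.[]
      ; ls-proper  = (m>0 c (suc d) (suc e) , n/p<n) All.∷ (m>0 (suc c) d (suc e) , n/q<n)
                     All.∷ (m>0 (suc c) (suc d) e , n/r<n) All.∷ (m>0 c d e , n/pqr<n) All.∷ All.[]
      ; balance    = λ {x} x<n →
          inclusion-exclusion₃ (does (x ∣? n/p)) (does (x ∣? n/q)) (does (x ∣? n/r))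
            (does-⇔ (divides-n⇔ x<n) (x ∣? n) (x ∣? n/p ⊎-dec x ∣? n/q ⊎-dec x ∣? n/r))
            (does-⇔ divides-n/pq⇔ (x ∣? n/pq) (x ∣? n/p ×-dec x ∣? n/q))
            (does-⇔ divides-n/pr⇔ (x ∣? n/pr) (x ∣? n/p ×-dec x ∣? n/r))
            (does-⇔ divides-n/qr⇔ (x ∣? n/qr) (x ∣? n/q ×-dec x ∣? n/r))
            (does-⇔ divides-n/pqr⇔ (x ∣? n/pqr) (x ∣? n/p ×-dec x ∣? n/q ×-dec x ∣? n/r))
      }

open import Data.Integer using (ℤ; +_; _+_; _-_; _*_)
open import Data.Integer.Properties using (pos-*)
open import Data.Integer.Tactic.RingSolver using (solve; solve-∀)
import Data.Nat as ℕ
open DivisorSums using (InclusionExclusion; b-balance)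

ℤ-balance : ∀ B X L n Y K → B + + 2 * X + L ≡ n + + 2 * Y + K → B ≡ + 2 * (Y - X) + (n - L + K)
ℤ-balance B X L n Y K eq = begin
  B                                ≡⟨ solve (B ∷ X ∷ L ∷ []) ⟩
  B + + 2 * X + L - (+ 2 * X + L)  ≡⟨ cong (_- (+ 2 * X + L)) eq ⟩
  n + + 2 * Y + K - (+ 2 * X + L)  ≡⟨ solve (X ∷ L ∷ n ∷ Y ∷ K ∷ []) ⟩
  + 2 * (Y - X) + (n - L + K)      ∎

ℕ-balance⇒ℤ : ∀ B X L n Y K → B ℕ.+ 2 ℕ.* X ℕ.+ L ≡ n ℕ.+ 2 ℕ.* Y ℕ.+ K →
  + B ≡ + 2 * (+ Y - + X) + (+ n - + L + + K)
ℕ-balance⇒ℤ B X L n Y K eq = ℤ-balance (+ B) (+ X) (+ L) (+ n) (+ Y) (+ K) (begin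
  + B + + 2 * + X + + L     ≡⟨ cong (λ t → + B + t + + L) (pos-* 2 X) ⟨
  + (B ℕ.+ 2 ℕ.* X ℕ.+ L)   ≡⟨ cong +_ eq ⟩
  + (n ℕ.+ 2 ℕ.* Y ℕ.+ K)   ≡⟨ cong (λ t → + n + t + + K) (pos-* 2 Y) ⟩
  + n + + 2 * + Y + + K     ∎)

b-by-cofactors : ∀ {n ks ls} → InclusionExclusion n ks ls →
  + b n ≡ + 2 * (+ sum (map b ls) - + sum (map b ks)) + (+ n - + sum ls + + sum ks)
b-by-cofactors {n} {ks} {ls} ie =
  ℕ-balance⇒ℤ (b n) (sum (map b ks)) (sum ls) n (sum (map b ls)) (sum ks) (b-balance ie)

pos-cofactor : ∀ s {M N} → M ≡ s ℕ.* N → + M ≡ + s * + N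
pos-cofactor s {N = N} M≡s*N = trans (cong +_ M≡s*N) (pos-* s N)

-- The trailing + 0 in the totient identities are the ends of the list sums in b-by-cofactors.
totient₁ : ∀ P N {M} → M ≡ P * N → M - (N + + 0) + + 0 ≡ (P - + 1) * N
totient₁ P N refl = solve (P ∷ N ∷ [])

b-prime-power : ∀ {p} → Prime p → ∀ c →
  + b (p ^ suc c) ≡ + 2 * + b (p ^ c) + (+ p - + 1) * + (p ^ c)
b-prime-power {p} p-prime c = trans (b-by-cofactors (PrimePower.inclusion-exclusion p-prime c))
  (cong₂ _+_ (cong (+ 2 *_) (regroup (+ b (p ^ c)))) (totient₁ (+ p) (+ (p ^ c)) (pos-cofactor p refl)))
  where
  regroup : ∀ x → x + + 0 - + 0 ≡ x
  regroup = solve-∀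

totient₂ : ∀ P Q N {M M/p M/q} → M ≡ P * M/p → M/p ≡ Q * N → M/q ≡ P * N →
  M - (M/p + (M/q + + 0)) + (N + + 0) ≡ (P - + 1) * (Q - + 1) * N
totient₂ P Q N refl refl refl = solve (P ∷ Q ∷ N ∷ [])

b-two-prime-powers : ∀ {p q} → Prime p → Prime q → p ≢ q → ∀ c d →
  + b (p ^ suc c ℕ.* q ^ suc d)
    ≡ + 2 * (+ b (p ^ c ℕ.* q ^ suc d) + + b (p ^ suc c ℕ.* q ^ d) - + b (p ^ c ℕ.* q ^ d))
      + (+ p - + 1) * (+ q - + 1) * + (p ^ c ℕ.* q ^ d)
b-two-prime-powers {p} {q} p-prime q-prime p≢q c d = trans (b-by-cofactors inclusion-exclusion)
  (cong₂ _+_ (cong (+ 2 *_) (regroup (+ b n/p) (+ b n/q) (+ b n/pq)))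
             (totient₂ (+ p) (+ q) (+ n/pq)
               (pos-cofactor p (m-sucᵖ c (suc d))) (pos-cofactor q (m-sucᵠ c d))
               (pos-cofactor p (m-sucᵖ c d))))
  where
  open TwoPrimePowers p-prime q-prime p≢q
  open Cofactors c d
  regroup : ∀ x₁ x₂ y₁ → (x₁ + (x₂ + + 0)) - (y₁ + + 0) ≡ x₁ + x₂ - y₁
  regroup = solve-∀

totient₃ : ∀ P Q R N {M M/p M/q M/r M/pq M/pr M/qr} →
  M ≡ P * M/p → M/p ≡ Q * M/pq → M/q ≡ P * M/pq → M/r ≡ P * M/pr →
  M/pq ≡ R * N → M/pr ≡ Q * N → M/qr ≡ P * N →
  M - (M/p + (M/q + (M/r + (N + + 0)))) + (M/pq + (M/pr + (M/qr + + 0)))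
    ≡ (P - + 1) * (Q - + 1) * (R - + 1) * N
totient₃ P Q R N refl refl refl refl refl refl refl = solve (P ∷ Q ∷ R ∷ N ∷ [])

b-three-prime-powers : ∀ {p q r} → Prime p → Prime q → Prime r →
  p ≢ q → p ≢ r → q ≢ r → ∀ c d e →
  + b (p ^ suc c ℕ.* q ^ suc d ℕ.* r ^ suc e)
    ≡ + 2 * (+ b (p ^ c ℕ.* q ^ suc d ℕ.* r ^ suc e)
             + + b (p ^ suc c ℕ.* q ^ d ℕ.* r ^ suc e)
             + + b (p ^ suc c ℕ.* q ^ suc d ℕ.* r ^ e)
             - + b (p ^ suc c ℕ.* q ^ d ℕ.* r ^ e)
             - + b (p ^ c ℕ.* q ^ suc d ℕ.* r ^ e)
             - + b (p ^ c ℕ.* q ^ d ℕ.* r ^ suc e)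
             + + b (p ^ c ℕ.* q ^ d ℕ.* r ^ e))
      + (+ p - + 1) * (+ q - + 1) * (+ r - + 1) * + (p ^ c ℕ.* q ^ d ℕ.* r ^ e)
b-three-prime-powers {p} {q} {r} p-prime q-prime r-prime p≢q p≢r q≢r c d e =
  trans (b-by-cofactors inclusion-exclusion)
    (cong₂ _+_ (cong (+ 2 *_) (regroup (+ b n/p) (+ b n/q) (+ b n/r) (+ b n/pqr)
                                       (+ b n/pq) (+ b n/pr) (+ b n/qr)))
               (totient₃ (+ p) (+ q) (+ r) (+ n/pqr)
                 (pos-cofactor p (m-sucᵖ c (suc d) (suc e))) (pos-cofactor q (m-sucᵠ c d (suc e)))
                 (pos-cofactor p (m-sucᵖ c d (suc e))) (pos-cofactor p (m-sucᵖ c (suc d) e))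
                 (pos-cofactor r (m-sucʳ c d e)) (pos-cofactor q (m-sucᵠ c d e))
                 (pos-cofactor p (m-sucᵖ c d e))))
  where
  open ThreePrimePowers p-prime q-prime r-prime p≢q p≢r q≢r
  open Cofactors c d e
  regroup : ∀ x₁ x₂ x₃ x₄ y₁ y₂ y₃ →
    (x₁ + (x₂ + (x₃ + (x₄ + + 0)))) - (y₁ + (y₂ + (y₃ + + 0)))
      ≡ x₁ + x₂ + x₃ - y₃ - y₂ - y₁ + x₄
  regroup = solve-∀

theorem6 : (p q r c d e : ℕ) → Prime p → Prime q → Prime r →
    p ≢ q → p ≢ r → q ≢ r →
    ((+ b (p ^ suc c)) ≡ + 2 * + b (p ^ c) + (+ p - + 1) * + (p ^ c))
    × ((+ b (p ^ suc c Data.Nat.* q ^ suc d))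
        ≡ + 2 * (+ b (p ^ c Data.Nat.* q ^ suc d) + + b (p ^ suc c Data.Nat.* q ^ d)
                 - + b (p ^ c Data.Nat.* q ^ d))
          + (+ p - + 1) * (+ q - + 1) * + (p ^ c Data.Nat.* q ^ d))
    × ((+ b (p ^ suc c Data.Nat.* q ^ suc d Data.Nat.* r ^ suc e))
        ≡ + 2 * (+ b (p ^ c Data.Nat.* q ^ suc d Data.Nat.* r ^ suc e)
                 + + b (p ^ suc c Data.Nat.* q ^ d Data.Nat.* r ^ suc e)
                 + + b (p ^ suc c Data.Nat.* q ^ suc d Data.Nat.* r ^ e)
                 - + b (p ^ suc c Data.Nat.* q ^ d Data.Nat.* r ^ e)
                 - + b (p ^ c Data.Nat.* q ^ suc d Data.Nat.* r ^ e)
                 - + b (p ^ c Data.Nat.* q ^ d Data.Nat.* r ^ suc e)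
                 + + b (p ^ c Data.Nat.* q ^ d Data.Nat.* r ^ e))
          + (+ p - + 1) * (+ q - + 1) * (+ r - + 1)
            * + (p ^ c Data.Nat.* q ^ d Data.Nat.* r ^ e))
theorem6 p q r c d e p-prime q-prime r-prime p≢q p≢r q≢r =
    b-prime-power p-prime c
  , b-two-prime-powers p-prime q-prime p≢q c d
  , b-three-prime-powers p-prime q-prime r-prime p≢q p≢r q≢r c d e
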